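{- Let $d\ge 2$ and let $A=(a_\alpha)_{\alpha\in I_3^d}$ be the $d$-dimensional matrix of order $3$ defined as follows (where $|\alpha|_j$ is the number of coordinates of $\alpha$ equal to $j$). If $d$ is even: $a_\alpha=\tfrac13$ if $|\alpha|_0,|\alpha|_1,|\alpha|_2\ne0$; $a_\alpha=0$ if $|\alpha|_0=0$ and $|\alpha|_1,|\alpha|_2$ are even and $\ne d$; $a_\alpha=\tfrac23$ if $|\alpha|_0=0$ and $|\alpha|_1,|\alpha|_2$ are odd; $a_\alpha=\tfrac23$ if $|\alpha|_1=0$ and $|\alpha|_0,|\alpha|_2$ are even and $\ne d$; $a_\alpha=0$ if $|\alpha|_1=0$ and $|\alpha|_0,|\alpha|_2$ are odd; $a_\alpha=\tfrac23$ if $|\alpha|_2=0$ and $|\alpha|_0,|\alpha|_1$ are even and $\ne d$; $a_\alpha=0$ if $|\alpha|_2=0$ and $|\alpha|_0,|\alpha|_1$ are odd; $a_\alpha=\tfrac13$ if $|\alpha|_1=d$ or $|\alpha|_2=d$; $a_\alpha=1$ if $|\alpha|_0=d$. If $d$ is odd: $a_\alpha=\tfrac13$ if $|\alpha|_0,|\alpha|_1,|\alpha|_2\ne0$; $a_\alpha=0$ if $|\alpha|_0=0$, $|\alpha|_1\ne d$ is odd and $|\alpha|_2$ is even; $a_\alpha=\tfrac23$ if $|\alpha|_0=0$, $|\alpha|_1$ is even and $|\alpha|_2\ne d$ is odd; $a_\alpha=\tfrac23$ if $|\alpha|_1=0$, $|\alpha|_0\ne d$ is odd and $|\alpha|_2$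 is even; $a_\alpha=0$ if $|\alpha|_1=0$, $|\alpha|_0$ is even and $|\alpha|_2\ne d$ is odd; $a_\alpha=0$ if $|\alpha|_2=0$, $|\alpha|_0\ne d$ is odd and $|\alpha|_1$ is even; $a_\alpha=\tfrac23$ if $|\alpha|_2=0$, $|\alpha|_0$ is even and $|\alpha|_1\ne d$ is odd; $a_\alpha=\tfrac13$ if $|\alpha|_0=d$, $|\alpha|_1=d$ or $|\alpha|_2=d$. Then $A$ is a polystochastic matrix, and the number of its nonzero entries is $N(A)=3^d-3\cdot2^{d-1}+2$ if $d$ is even and $N(A)=3^d-3\cdot2^{d-1}+3$ if $d$ is odd.
   Context: $I_3^d=\{(\alpha_1,\dots,\alpha_d):\alpha_i\in\{0,1,2\}\}$. A line is the set of entries of a $d$-dimensional matrix obtained by fixing all but one index position. A nonnegative matrix is polystochastic if each line sums to $1$. $N(A)$ denotes the number of nonzero entries of $A$. -}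

module Defs where

open import Data.Bool using (Bool; true; false; _∧_; _∨_; not; if_then_else_)
open import Data.Nat using (ℕ; zero; suc; _≡ᵇ_)
open import Data.Fin using (Fin; toℕ)
open import Data.Vec using (Vec; []; _∷_; toList; _[_]≔_)
open import Data.List using (List; []; _∷_; concatMap; map; length; filter; sum)
open import Data.List.Relation.Unary.All using (All)
open import Data.Fin using (zero; suc)
open import Data.Rational using (ℚ; 0ℚ; 1ℚ; _/_; _≤_; _+_)
open import Data.Rational.Properties using (_≟_)
open import Data.Integer using (+_)
open import Relation.Nullary using (¬_)
open import Relation.Nullary.Decidable using (¬?)
open import Relation.Binary.PropositionalEquality using (_≡_)
open import Data.Product using (_×_)

Index : ℕ → Set
Index d = Vec (Fin 3) d

Matrix : ℕ → Set
Matrix d = Index d → ℚ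

allIndices : (d : ℕ) → List (Index d)
allIndices zero    = [] ∷ []
allIndices (suc d) =
  concatMap (λ α → (zero ∷ α) ∷ (suc zero ∷ α) ∷ (suc (suc zero) ∷ α) ∷ []) (allIndices d)

cnt : ∀ {d} → ℕ → Index d → ℕ
cnt j α = length (filter (λ x → Data.Nat._≟_ (toℕ x) j) (toList α))

isEven : ℕ → Bool
isEven zero          = true
isEven (suc zero)    = false
isEven (suc (suc n)) = isEven n

isOdd : ℕ → Bool
isOdd n = not (isEven n)

nz : ℕ → Bool
nz n = not (n ≡ᵇ 0)

⅓ ⅔ : ℚ
⅓ = + 1 / 3
⅔ = + 2 / 3

-- entry a_α as a function of (d, |α|_0, |α|_1, |α|_2), case by case as in
-- the paper (the cases are mutually exclusive and exhaustive, so the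
-- order of the if-chain and the final fallback 0ℚ are immaterial).
entryEven : ℕ → ℕ → ℕ → ℕ → ℚ
entryEven d c0 c1 c2 =
  if nz c0 ∧ nz c1 ∧ nz c2 then ⅓ else
  if (c0 ≡ᵇ 0) ∧ isEven c1 ∧ isEven c2 ∧ not (c1 ≡ᵇ d) ∧ not (c2 ≡ᵇ d) then 0ℚ else
  if (c0 ≡ᵇ 0) ∧ isOdd c1 ∧ isOdd c2 then ⅔ else
  if (c1 ≡ᵇ 0) ∧ isEven c0 ∧ isEven c2 ∧ not (c0 ≡ᵇ d) ∧ not (c2 ≡ᵇ d) then ⅔ else
  if (c1 ≡ᵇ 0) ∧ isOdd c0 ∧ isOdd c2 then 0ℚ else
  if (c2 ≡ᵇ 0) ∧ isEven c0 ∧ isEven c1 ∧ not (c0 ≡ᵇ d) ∧ not (c1 ≡ᵇ d) then ⅔ else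
  if (c2 ≡ᵇ 0) ∧ isOdd c0 ∧ isOdd c1 then 0ℚ else
  if (c1 ≡ᵇ d) ∨ (c2 ≡ᵇ d) then ⅓ else
  if c0 ≡ᵇ d then 1ℚ else
  0ℚ

entryOdd : ℕ → ℕ → ℕ → ℕ → ℚ
entryOdd d c0 c1 c2 =
  if nz c0 ∧ nz c1 ∧ nz c2 then ⅓ else
  if (c0 ≡ᵇ 0) ∧ not (c1 ≡ᵇ d) ∧ isOdd c1 ∧ isEven c2 then 0ℚ else
  if (c0 ≡ᵇ 0) ∧ isEven c1 ∧ not (c2 ≡ᵇ d) ∧ isOdd c2 then ⅔ else
  if (c1 ≡ᵇ 0) ∧ not (c0 ≡ᵇ d) ∧ isOdd c0 ∧ isEven c2 then ⅔ else
  if (c1 ≡ᵇ 0) ∧ isEven c0 ∧ not (c2 ≡ᵇ d) ∧ isOdd c2 then 0ℚ else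
  if (c2 ≡ᵇ 0) ∧ not (c0 ≡ᵇ d) ∧ isOdd c0 ∧ isEven c1 then 0ℚ else
  if (c2 ≡ᵇ 0) ∧ isEven c0 ∧ not (c1 ≡ᵇ d) ∧ isOdd c1 then ⅔ else
  if (c0 ≡ᵇ d) ∨ (c1 ≡ᵇ d) ∨ (c2 ≡ᵇ d) then ⅓ else
  0ℚ

A : (d : ℕ) → Matrix d
A d α = if isEven d then entryEven d (cnt 0 α) (cnt 1 α) (cnt 2 α)
                    else entryOdd  d (cnt 0 α) (cnt 1 α) (cnt 2 α)

lineSum : ∀ {d} → Matrix d → Index d → Fin d → ℚ
lineSum M α i = M (α [ i ]≔ zero) + (M (α [ i ]≔ suc zero) + M (α [ i ]≔ suc (suc zero)))

Polystochastic : ∀ {d} → Matrix d → Set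
Polystochastic {d} M = (∀ α → 0ℚ ≤ M α) × (∀ (α : Index d) (i : Fin d) → lineSum M α i ≡ 1ℚ)

N : ∀ {d} → Matrix d → ℕ
N {d} M = length (filter (λ α → ¬? (M α ≟ 0ℚ)) (allIndices d))

{-# OPTIONS --safe #-}
module Submission where

open import Defs
open import Data.Nat using (ℕ; _≤_; _+_; _*_; _∸_; _^_)
open import Data.Product using (_×_)
open import Data.Bool using (true; false)
open import Relation.Binary.PropositionalEquality using (_≡_)

open import Data.Nat using (zero; suc; _≡ᵇ_; s≤s; z≤n)
open import Data.Nat.Properties
  using (+-assoc; +-comm; +-suc; +-identityʳ; +-cancelˡ-≤; [m+n]∸[m+o]≡n∸o; m∸n+n≡m; *-monoʳ-≤; ^-monoˡ-≤)
  renaming (_≟_ to _≟ℕ_)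
open import Data.Nat.ListAction using (sum)
open import Data.Nat.Tactic.RingSolver using (solve-∀)
open import Data.Bool using (Bool; not; _∧_; if_then_else_)
open import Data.Fin using (Fin; suc)
open import Data.Fin.Patterns using (0F; 1F; 2F)
open import Data.Vec using ([]; _∷_; removeAt; _[_]≔_)
open import Data.List using (List; []; _∷_; map; filter; length; concatMap)
open import Data.List.Properties using (map-cong)
open import Data.Product using (_,_)
open import Data.Rational using (ℚ; 0ℚ; 1ℚ; _≟_; _≤?_) renaming (_+_ to _+ℚ_; _≤_ to _≤ℚ_)
open import Function using (_∘_; flip; const)
open import Relation.Nullary.Decidable using (Dec; does; map′; _×-dec_; from-yes; ¬?)
open import Relation.Unary using (Decidable)
open import Relation.Binary.PropositionalEquality using (refl; sym; trans; cong; cong₂; subst; module ≡-Reasoning)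

-- The entry a_α depends only on the classes (zero, positive even, odd) of the
-- three counts |α|_0, |α|_1, |α|_2: the parity of d = |α|_0 + |α|_1 + |α|_2 and
-- each test |α|_j = d (the other two counts vanish) are determined by them.
-- Changing one coordinate of α changes one count by one, so a line sum is a
-- function of the classes of the counts of the remaining d - 1 coordinates, and
-- the 27 possible cases are checked by evaluation, as is nonnegativity.
--
-- An entry vanishes exactly when letter 0 is absent, letter 1 present and the
-- number of 2s positive even, or when the pattern "letter 0 absent, number of
-- 1s odd, letter 2 present" holds after one of the two nontrivial cyclic
-- relabellings of the letters, which do not change the number of such words.
-- Among the 2^n words of length n ≥ 1 over two letters, half have an even
-- number of a given letter, and the presence conditions only exclude constant
-- words. This gives 3·2^(d-1) - 2 zero entries for even d and 3·2^(d-1) - 3 for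
-- odd d.

-- Classes of counts

data Class : Set where
  absent even odd : Class

next : Class → Class
next absent = odd
next even   = odd
next odd    = even

class : ℕ → Class
class zero    = absent
class (suc n) = next (class n)

_==_ : Class → Class → Bool
absent == absent = true
even   == even   = true
odd    == odd    = true
_      == _      = false

_⊕_ : Class → Class → Class
absent ⊕ y = y
odd    ⊕ y = next y
even   ⊕ y = next (next y)

next-⊕ : ∀ x y → next x ⊕ y ≡ next (x ⊕ y)
next-⊕ absent y      = refl
next-⊕ odd    y      = refl
next-⊕ even   absent = refl
next-⊕ even   even   = refl
next-⊕ even   odd    = refl

class-+ : ∀ m n → class (m + n) ≡ class m ⊕ class n
class-+ zero    n = refl
class-+ (suc m) n = trans (cong next (class-+ m n)) (sym (next-⊕ (class m) (class n)))

≡ᵇ0-class : ∀ n → (n ≡ᵇ 0) ≡ (class n == absent)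
≡ᵇ0-class zero = refl
≡ᵇ0-class (suc n) with class n
... | absent = refl
... | even   = refl
... | odd    = refl

isEven-class : ∀ n → isEven n ≡ not (class n == odd)
isEven-class zero          = refl
isEven-class (suc zero)    = refl
isEven-class (suc (suc n)) with class n | isEven-class n
... | absent | p = p
... | even   | p = p
... | odd    | p = p

-- A data type rather than an equation, so that the counts can be inferred.
infix 4 _∼_
data _∼_ (m n : ℕ) : Set where
  sameClass : class m ≡ class n → m ∼ n

∼-+ : ∀ {m n m′ n′} → m ∼ m′ → n ∼ n′ → m + n ∼ m′ + n′
∼-+ {m} {n} {m′} {n′} (sameClass p) (sameClass q) = sameClass (begin
  class (m + n)        ≡⟨ class-+ m n ⟩
  class m ⊕ class n    ≡⟨ cong₂ _⊕_ p q ⟩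
  class m′ ⊕ class n′  ≡⟨ class-+ m′ n′ ⟨
  class (m′ + n′)      ∎)
  where open ≡-Reasoning

∼⇒isEven≡ : ∀ {m n} → m ∼ n → isEven m ≡ isEven n
∼⇒isEven≡ {m} {n} (sameClass p) =
  trans (isEven-class m) (trans (cong (λ x → not (x == odd)) p) (sym (isEven-class n)))

∼⇒≡ᵇ0≡ : ∀ {m n} → m ∼ n → (m ≡ᵇ 0) ≡ (n ≡ᵇ 0)
∼⇒≡ᵇ0≡ {m} {n} (sameClass p) =
  trans (≡ᵇ0-class m) (trans (cong (_== absent) p) (sym (≡ᵇ0-class n)))

[m≡ᵇm+n]≡[n≡ᵇ0] : ∀ m n → (m ≡ᵇ m + n) ≡ (n ≡ᵇ 0)
[m≡ᵇm+n]≡[n≡ᵇ0] zero    zero    = refl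
[m≡ᵇm+n]≡[n≡ᵇ0] zero    (suc n) = refl
[m≡ᵇm+n]≡[n≡ᵇ0] (suc m) n       = [m≡ᵇm+n]≡[n≡ᵇ0] m n

≡ᵇ-total-∼ : ∀ m m′ {n n′ d d′} → m + n ≡ d → m′ + n′ ≡ d′ → n ∼ n′ → (m ≡ᵇ d) ≡ (m′ ≡ᵇ d′)
≡ᵇ-total-∼ m m′ {n} {n′} refl refl p =
  trans ([m≡ᵇm+n]≡[n≡ᵇ0] m n) (trans (∼⇒≡ᵇ0≡ p) (sym ([m≡ᵇm+n]≡[n≡ᵇ0] m′ n′)))

entry : ℕ → ℕ → ℕ → ℕ → ℚ
entry d c₀ c₁ c₂ = if isEven d then entryEven d c₀ c₁ c₂ else entryOdd d c₀ c₁ c₂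

-- entryEven and entryOdd inspect the counts only through these ten tests.
entry-cong : ∀ {d c₀ c₁ c₂ d′ c₀′ c₁′ c₂′} → isEven d ≡ isEven d′ →
  (c₀ ≡ᵇ 0) ≡ (c₀′ ≡ᵇ 0) → isEven c₀ ≡ isEven c₀′ → (c₀ ≡ᵇ d) ≡ (c₀′ ≡ᵇ d′) →
  (c₁ ≡ᵇ 0) ≡ (c₁′ ≡ᵇ 0) → isEven c₁ ≡ isEven c₁′ → (c₁ ≡ᵇ d) ≡ (c₁′ ≡ᵇ d′) →
  (c₂ ≡ᵇ 0) ≡ (c₂′ ≡ᵇ 0) → isEven c₂ ≡ isEven c₂′ → (c₂ ≡ᵇ d) ≡ (c₂′ ≡ᵇ d′) →
  entry d c₀ c₁ c₂ ≡ entry d′ c₀′ c₁′ c₂′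
entry-cong p z₀ e₀ t₀ z₁ e₁ t₁ z₂ e₂ t₂
  rewrite p | z₀ | e₀ | t₀ | z₁ | e₁ | t₁ | z₂ | e₂ | t₂ = refl

entryOfCounts : ℕ → ℕ → ℕ → ℚ
entryOfCounts c₀ c₁ c₂ = entry (c₀ + c₁ + c₂) c₀ c₁ c₂

entryOfCounts-∼ : ∀ {a₀ a₁ a₂ b₀ b₁ b₂} → a₀ ∼ b₀ → a₁ ∼ b₁ → a₂ ∼ b₂ →
                  entryOfCounts a₀ a₁ a₂ ≡ entryOfCounts b₀ b₁ b₂
entryOfCounts-∼ {a₀} {a₁} {a₂} {b₀} {b₁} {b₂} p₀ p₁ p₂ =
  entry-cong {a₀ + a₁ + a₂} {a₀} {a₁} {a₂} {b₀ + b₁ + b₂} {b₀} {b₁} {b₂}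
    (∼⇒isEven≡ (∼-+ (∼-+ p₀ p₁) p₂))
    (∼⇒≡ᵇ0≡ p₀) (∼⇒isEven≡ p₀)
    (≡ᵇ-total-∼ a₀ b₀ (sym (+-assoc a₀ a₁ a₂)) (sym (+-assoc b₀ b₁ b₂)) (∼-+ p₁ p₂))
    (∼⇒≡ᵇ0≡ p₁) (∼⇒isEven≡ p₁)
    (≡ᵇ-total-∼ a₁ b₁ (middle a₀ a₁ a₂) (middle b₀ b₁ b₂) (∼-+ p₀ p₂))
    (∼⇒≡ᵇ0≡ p₂) (∼⇒isEven≡ p₂)
    (≡ᵇ-total-∼ a₂ b₂ (+-comm a₂ (a₀ + a₁)) (+-comm b₂ (b₀ + b₁)) (∼-+ p₀ p₁))
  where
  middle : ∀ m n o → n + (m + o) ≡ m + n + o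
  middle m n o = trans (sym (+-assoc n m o)) (cong (_+ o) (+-comm n m))

rep : Class → ℕ
rep absent = 0
rep even   = 2
rep odd    = 1

class-rep : ∀ x → class (rep x) ≡ x
class-rep absent = refl
class-rep even   = refl
class-rep odd    = refl

∼-rep : ∀ n → n ∼ rep (class n)
∼-rep n = sameClass (sym (class-rep (class n)))

Type : Set
Type = Class × Class × Class

type : ∀ {d} → Index d → Type
type α = class (cnt 0 α) , class (cnt 1 α) , class (cnt 2 α)

entryOf : Type → ℚ
entryOf (x , y , z) = entryOfCounts (rep x) (rep y) (rep z)

cnt-sum : ∀ {d} (α : Index d) → cnt 0 α + cnt 1 α + cnt 2 α ≡ d
cnt-sum []       = refl
cnt-sum (0F ∷ α) = cong suc (cnt-sum α)
cnt-sum (1F ∷ α) = trans (cong (_+ cnt 2 α) (+-suc (cnt 0 α) (cnt 1 α))) (cong suc (cnt-sum α))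
cnt-sum (2F ∷ α) = trans (+-suc (cnt 0 α + cnt 1 α) (cnt 2 α)) (cong suc (cnt-sum α))

A≡entryOf-type : ∀ {d} (α : Index d) → A d α ≡ entryOf (type α)
A≡entryOf-type {d} α = begin
  entry d c₀ c₁ c₂         ≡⟨ cong (λ n → entry n c₀ c₁ c₂) (cnt-sum α) ⟨
  entryOfCounts c₀ c₁ c₂   ≡⟨ entryOfCounts-∼ (∼-rep c₀) (∼-rep c₁) (∼-rep c₂) ⟩
  entryOf (type α)         ∎
  where
  open ≡-Reasoning
  c₀ = cnt 0 α
  c₁ = cnt 1 α
  c₂ = cnt 2 α

∀-Class? : ∀ {P : Class → Set} → Decidable P → Dec (∀ x → P x)
∀-Class? P? = map′ (λ (a , e , o) → λ { absent → a ; even → e ; odd → o })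
                   (λ h → h absent , h even , h odd)
                   (P? absent ×-dec P? even ×-dec P? odd)

∀-Class²? : ∀ {P : Class → Class → Set} → (∀ y z → Dec (P y z)) → Dec (∀ y z → P y z)
∀-Class²? P? = ∀-Class? λ y → ∀-Class? λ z → P? y z

∀-Type? : ∀ {P : Type → Set} → Decidable P → Dec (∀ s → P s)
∀-Type? P? = map′ (λ h (x , y , z) → h x y z) (λ h x y z → h (x , y , z))
                  (∀-Class²? λ x y → ∀-Class? λ z → P? (x , y , z))

-- Polystochasticity

bump : Fin 3 → Type → Type
bump 0F (x , y , z) = next x , y , z
bump 1F (x , y , z) = x , next y , z
bump 2F (x , y , z) = x , y , next z

type-∷ : ∀ {d} k (α : Index d) → type (k ∷ α) ≡ bump k (type α)
type-∷ 0F α = refl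
type-∷ 1F α = refl
type-∷ 2F α = refl

bump-comm : ∀ j k s → bump j (bump k s) ≡ bump k (bump j s)
bump-comm 0F 0F s = refl
bump-comm 0F 1F s = refl
bump-comm 0F 2F s = refl
bump-comm 1F 0F s = refl
bump-comm 1F 1F s = refl
bump-comm 1F 2F s = refl
bump-comm 2F 0F s = refl
bump-comm 2F 1F s = refl
bump-comm 2F 2F s = refl

type-[]≔ : ∀ {d} (α : Index (suc d)) i k → type (α [ i ]≔ k) ≡ bump k (type (removeAt α i))
type-[]≔ (j ∷ α)     0F      k = type-∷ k α
type-[]≔ (j ∷ β ∷ α) (suc i) k = begin
  type (j ∷ (β ∷ α) [ i ]≔ k)                 ≡⟨ type-∷ j _ ⟩
  bump j (type ((β ∷ α) [ i ]≔ k))            ≡⟨ cong (bump j) (type-[]≔ (β ∷ α) i k) ⟩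
  bump j (bump k (type (removeAt (β ∷ α) i))) ≡⟨ bump-comm j k _ ⟩
  bump k (bump j (type (removeAt (β ∷ α) i))) ≡⟨ cong (bump k) (type-∷ j _) ⟨
  bump k (type (j ∷ removeAt (β ∷ α) i))      ∎
  where open ≡-Reasoning

entryOf-nonneg : ∀ s → 0ℚ ≤ℚ entryOf s
entryOf-nonneg = from-yes (∀-Type? λ s → 0ℚ ≤? entryOf s)

lineOf : Type → ℚ
lineOf s = entryOf (bump 0F s) +ℚ (entryOf (bump 1F s) +ℚ entryOf (bump 2F s))

lineOf≡1 : ∀ s → lineOf s ≡ 1ℚ
lineOf≡1 = from-yes (∀-Type? λ s → lineOf s ≟ 1ℚ)

lineSum-A≡1 : ∀ {d} (α : Index d) i → lineSum (A d) α i ≡ 1ℚ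
lineSum-A≡1 {suc d} α i =
  trans (cong₂ _+ℚ_ (entry-at 0F) (cong₂ _+ℚ_ (entry-at 1F) (entry-at 2F)))
        (lineOf≡1 (type (removeAt α i)))
  where
  entry-at : ∀ k → A (suc d) (α [ i ]≔ k) ≡ entryOf (bump k (type (removeAt α i)))
  entry-at k = trans (A≡entryOf-type (α [ i ]≔ k)) (cong entryOf (type-[]≔ α i k))

A-polystochastic : ∀ d → Polystochastic (A d)
A-polystochastic d =
  (λ α → subst (0ℚ ≤ℚ_) (sym (A≡entryOf-type α)) (entryOf-nonneg (type α))) , lineSum-A≡1

-- Sums over all words

𝟙 : Bool → ℕ
𝟙 true  = 1
𝟙 false = 0

𝟙-not+𝟙 : ∀ b → 𝟙 (not b) + 𝟙 b ≡ 1
𝟙-not+𝟙 true  = refl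
𝟙-not+𝟙 false = refl

length-filter≡sum : ∀ {X : Set} {P : X → Set} (P? : Decidable P) xs →
                    length (filter P? xs) ≡ sum (map (𝟙 ∘ does ∘ P?) xs)
length-filter≡sum P? [] = refl
length-filter≡sum P? (x ∷ xs) with does (P? x)
... | true  = cong suc (length-filter≡sum P? xs)
... | false = length-filter≡sum P? xs

sum-map-concatMap : ∀ {X Y : Set} (g : Y → ℕ) (u v w : X → Y) xs →
  sum (map g (concatMap (λ x → u x ∷ v x ∷ w x ∷ []) xs)) ≡
  sum (map (g ∘ u) xs) + sum (map (g ∘ v) xs) + sum (map (g ∘ w) xs)
sum-map-concatMap g u v w []        = refl
sum-map-concatMap g u v w (x ∷ xs) = trans
  (cong (λ t → g (u x) + (g (v x) + (g (w x) + t))) (sum-map-concatMap g u v w xs))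
  (interchange (g (u x)) (g (v x)) (g (w x)) _ _ _)
  where
  interchange : ∀ a b c p q r → a + (b + (c + (p + q + r))) ≡ a + p + (b + q) + (c + r)
  interchange = solve-∀

-- sumWords n f is the sum of f (type α) over α ∈ I_3^n, see sum-map-type.
sumWords : ℕ → (Type → ℕ) → ℕ
sumWords zero    f = f (absent , absent , absent)
sumWords (suc n) f = sumWords n (f ∘ bump 0F) + sumWords n (f ∘ bump 1F) + sumWords n (f ∘ bump 2F)

sum-map-type : ∀ n f → sum (map (f ∘ type) (allIndices n)) ≡ sumWords n f
sum-map-type zero    f = +-identityʳ _
sum-map-type (suc n) f = trans
  (sum-map-concatMap (f ∘ type) (0F ∷_) (1F ∷_) (2F ∷_) (allIndices n))
  (cong₂ _+_ (cong₂ _+_ (sum-map-type n (f ∘ bump 0F)) (sum-map-type n (f ∘ bump 1F)))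
             (sum-map-type n (f ∘ bump 2F)))

sumWords-cong : ∀ n {f g} → (∀ s → f s ≡ g s) → sumWords n f ≡ sumWords n g
sumWords-cong zero    f≗g = f≗g _
sumWords-cong (suc n) f≗g =
  cong₂ _+_ (cong₂ _+_ (sumWords-cong n (f≗g ∘ bump 0F)) (sumWords-cong n (f≗g ∘ bump 1F)))
            (sumWords-cong n (f≗g ∘ bump 2F))

sumWords-+ : ∀ n f g → sumWords n (λ s → f s + g s) ≡ sumWords n f + sumWords n g
sumWords-+ zero    f g = refl
sumWords-+ (suc n) f g = trans
  (cong₂ _+_ (cong₂ _+_ (sumWords-+ n (f ∘ bump 0F) (g ∘ bump 0F))
                        (sumWords-+ n (f ∘ bump 1F) (g ∘ bump 1F)))
             (sumWords-+ n (f ∘ bump 2F) (g ∘ bump 2F)))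
  (interchange (sumWords n (f ∘ bump 0F)) (sumWords n (f ∘ bump 1F)) (sumWords n (f ∘ bump 2F))
               (sumWords n (g ∘ bump 0F)) (sumWords n (g ∘ bump 1F)) (sumWords n (g ∘ bump 2F)))
  where
  interchange : ∀ a b c p q r → a + p + (b + q) + (c + r) ≡ a + b + c + (p + q + r)
  interchange = solve-∀

sumWords-0 : ∀ n → sumWords n (const 0) ≡ 0
sumWords-0 zero    = refl
sumWords-0 (suc n) rewrite sumWords-0 n = refl

m+m+m≡3*m : ∀ m → m + m + m ≡ 3 * m
m+m+m≡3*m = solve-∀

sumWords-1 : ∀ n → sumWords n (const 1) ≡ 3 ^ n
sumWords-1 zero    = refl
sumWords-1 (suc n) = trans (cong (λ t → t + t + t) (sumWords-1 n)) (m+m+m≡3*m (3 ^ n))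

rotate : Type → Type
rotate (x , y , z) = y , z , x

-- rotate ∘ bump 0F is bump 2F ∘ rotate, and so on, definitionally.
sumWords-rotate : ∀ n f → sumWords n (f ∘ rotate) ≡ sumWords n f
sumWords-rotate zero    f = refl
sumWords-rotate (suc n) f = trans
  (cong₂ _+_ (cong₂ _+_ (sumWords-rotate n (f ∘ bump 2F)) (sumWords-rotate n (f ∘ bump 0F)))
             (sumWords-rotate n (f ∘ bump 1F)))
  (rotate-sum (sumWords n (f ∘ bump 0F)) (sumWords n (f ∘ bump 1F)) (sumWords n (f ∘ bump 2F)))
  where
  rotate-sum : ∀ a b c → c + a + b ≡ a + b + c
  rotate-sum = solve-∀

-- F is applied to the classes of the counts of the letters 1 and 2.
binary : (Class → Class → ℕ) → Type → ℕ
binary F (absent , y , z) = F y z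
binary F (even   , _ , _) = 0
binary F (odd    , _ , _) = 0

sumBinary : ℕ → (Class → Class → ℕ) → ℕ
sumBinary n F = sumWords n (binary F)

sumBinary-suc : ∀ n F → sumBinary (suc n) F ≡
                sumBinary n (λ y z → F (next y) z) + sumBinary n (λ y z → F y (next z))
sumBinary-suc n F = cong₂ _+_
  (cong₂ _+_ (trans (sumWords-cong n letter₀) (sumWords-0 n)) (sumWords-cong n letter₁))
  (sumWords-cong n letter₂)
  where
  letter₀ : ∀ s → binary F (bump 0F s) ≡ 0
  letter₀ (absent , _ , _) = refl
  letter₀ (even   , _ , _) = refl
  letter₀ (odd    , _ , _) = refl
  letter₁ : ∀ s → binary F (bump 1F s) ≡ binary (λ y z → F (next y) z) s
  letter₁ (absent , _ , _) = refl
  letter₁ (even   , _ , _) = refl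
  letter₁ (odd    , _ , _) = refl
  letter₂ : ∀ s → binary F (bump 2F s) ≡ binary (λ y z → F y (next z)) s
  letter₂ (absent , _ , _) = refl
  letter₂ (even   , _ , _) = refl
  letter₂ (odd    , _ , _) = refl

sumBinary-cong : ∀ n {F G} → (∀ y z → F y z ≡ G y z) → sumBinary n F ≡ sumBinary n G
sumBinary-cong n F≗G = sumWords-cong n λ where
  (absent , y , z) → F≗G y z
  (even   , _ , _) → refl
  (odd    , _ , _) → refl

sumBinary-+ : ∀ n F G → sumBinary n (λ y z → F y z + G y z) ≡ sumBinary n F + sumBinary n G
sumBinary-+ n F G = trans (sumWords-cong n split) (sumWords-+ n (binary F) (binary G))
  where
  split : ∀ s → binary (λ y z → F y z + G y z) s ≡ binary F s + binary G s
  split (absent , _ , _) = refl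
  split (even   , _ , _) = refl
  split (odd    , _ , _) = refl

sumBinary-1 : ∀ n → sumBinary n (λ _ _ → 1) ≡ 2 ^ n
sumBinary-1 zero    = refl
sumBinary-1 (suc n) =
  trans (sumBinary-suc n _) (trans (cong (λ t → t + t) (sumBinary-1 n)) (twice (2 ^ n)))
  where
  twice : ∀ t → t + t ≡ 2 * t
  twice = solve-∀

sumBinary-flip : ∀ n F → sumBinary n (flip F) ≡ sumBinary n F
sumBinary-flip zero    F = refl
sumBinary-flip (suc n) F = begin
  sumBinary (suc n) (flip F)                                               ≡⟨ sumBinary-suc n (flip F) ⟩
  sumBinary n (flip (λ y z → F y (next z))) + sumBinary n (flip (λ y z → F (next y) z))
    ≡⟨ cong₂ _+_ (sumBinary-flip n (λ y z → F y (next z))) (sumBinary-flip n (λ y z → F (next y) z)) ⟩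
  sumBinary n (λ y z → F y (next z)) + sumBinary n (λ y z → F (next y) z)
    ≡⟨ +-comm (sumBinary n (λ y z → F y (next z))) (sumBinary n (λ y z → F (next y) z)) ⟩
  sumBinary n (λ y z → F (next y) z) + sumBinary n (λ y z → F y (next z)) ≡⟨ sumBinary-suc n F ⟨
  sumBinary (suc n) F                                                      ∎
  where open ≡-Reasoning

-- Only the constant word 22…2 avoids the letter 1.
sumBinary-absent : ∀ n F → (∀ y z → F (next y) z ≡ 0) → sumBinary n F ≡ F absent (class n)
sumBinary-absent zero    F vanish = refl
sumBinary-absent (suc n) F vanish = begin
  sumBinary (suc n) F                                                      ≡⟨ sumBinary-suc n F ⟩
  sumBinary n (λ y z → F (next y) z) + sumBinary n (λ y z → F y (next z))
    ≡⟨ cong₂ _+_ (trans (sumBinary-cong n vanish) (sumBinary-absent n _ λ _ _ → refl))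
                 (sumBinary-absent n _ (λ y z → vanish y (next z))) ⟩
  F absent (class (suc n))                                                 ∎
  where open ≡-Reasoning

sumBinary-alternating : ∀ (q : Class → Bool) → (∀ z → q (next z) ≡ not (q z)) →
                        ∀ n → sumBinary (suc n) (λ _ z → 𝟙 (q z)) ≡ 2 ^ n
sumBinary-alternating q alternates n = begin
  sumBinary (suc n) (λ _ z → 𝟙 (q z))                                 ≡⟨ sumBinary-suc n _ ⟩
  sumBinary n (λ _ z → 𝟙 (q z)) + sumBinary n (λ _ z → 𝟙 (q (next z)))
    ≡⟨ +-comm (sumBinary n (λ _ z → 𝟙 (q z))) (sumBinary n (λ _ z → 𝟙 (q (next z)))) ⟩
  sumBinary n (λ _ z → 𝟙 (q (next z))) + sumBinary n (λ _ z → 𝟙 (q z)) ≡⟨ sumBinary-+ n _ _ ⟨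
  sumBinary n (λ _ z → 𝟙 (q (next z)) + 𝟙 (q z))
    ≡⟨ sumBinary-cong n (λ _ z → trans (cong (λ b → 𝟙 b + 𝟙 (q z)) (alternates z)) (𝟙-not+𝟙 (q z))) ⟩
  sumBinary n (λ _ _ → 1)                                             ≡⟨ sumBinary-1 n ⟩
  2 ^ n                                                               ∎
  where open ≡-Reasoning

-- Counting the zero entries

-- Weights on binary words, named by the required classes of the letters 1 and 2.
presentEven oddPresent absentEven absentOdd absentAny anyAbsent : Class → Class → ℕ
presentEven y z = 𝟙 (not (y == absent) ∧ z == even)
oddPresent  y z = 𝟙 (y == odd ∧ not (z == absent))
absentEven  y z = 𝟙 (y == absent ∧ z == even)
absentOdd   y z = 𝟙 (y == absent ∧ z == odd)
absentAny   y _ = 𝟙 (y == absent)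
anyAbsent   _ z = 𝟙 (z == absent)

isZeroEntry : Type → Bool
isZeroEntry s = does (entryOf s ≟ 0ℚ)

isZeroEntry-split : ∀ s → 𝟙 (isZeroEntry s) ≡
  binary presentEven s + binary oddPresent (rotate s) + binary oddPresent (rotate (rotate s))
isZeroEntry-split = from-yes (∀-Type? λ s → 𝟙 (isZeroEntry s) ≟ℕ
  binary presentEven s + binary oddPresent (rotate s) + binary oddPresent (rotate (rotate s)))

zeroCount : ℕ → ℕ
zeroCount n = sumWords n (𝟙 ∘ isZeroEntry)

zeroCount-split : ∀ n →
  zeroCount n ≡ sumBinary n presentEven + sumBinary n oddPresent + sumBinary n oddPresent
zeroCount-split n = begin
  sumWords n (𝟙 ∘ isZeroEntry)
    ≡⟨ sumWords-cong n isZeroEntry-split ⟩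
  sumWords n (λ s → P s + Q (rotate s) + Q (rotate (rotate s)))
    ≡⟨ sumWords-+ n (λ s → P s + Q (rotate s)) (Q ∘ rotate ∘ rotate) ⟩
  sumWords n (λ s → P s + Q (rotate s)) + sumWords n (Q ∘ rotate ∘ rotate)
    ≡⟨ cong₂ _+_ (sumWords-+ n P (Q ∘ rotate))
                 (trans (sumWords-rotate n (Q ∘ rotate)) (sumWords-rotate n Q)) ⟩
  sumWords n P + sumWords n (Q ∘ rotate) + sumWords n Q
    ≡⟨ cong (λ t → sumWords n P + t + sumWords n Q) (sumWords-rotate n Q) ⟩
  sumWords n P + sumWords n Q + sumWords n Q
    ∎
  where
  open ≡-Reasoning
  P = binary presentEven
  Q = binary oddPresent

sumBinary-anyAbsent : ∀ n → sumBinary n anyAbsent ≡ 1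
sumBinary-anyAbsent n = trans (sumBinary-flip n absentAny)
  (sumBinary-absent n absentAny λ { absent _ → refl ; even _ → refl ; odd _ → refl })

sumBinary-presentEven : ∀ n → sumBinary n presentEven + 𝟙 (class n == even) + 1 ≡
                              sumBinary n (λ _ z → 𝟙 (not (z == odd)))
sumBinary-presentEven n = begin
  sumBinary n presentEven + 𝟙 (class n == even) + 1
    ≡⟨ cong₂ (λ a b → sumBinary n presentEven + a + b)
             (sumBinary-absent n absentEven λ { absent _ → refl ; even _ → refl ; odd _ → refl })
             (sumBinary-anyAbsent n) ⟨
  sumBinary n presentEven + sumBinary n absentEven + sumBinary n anyAbsent
    ≡⟨ cong (_+ sumBinary n anyAbsent) (sumBinary-+ n presentEven absentEven) ⟨
  sumBinary n (λ y z → presentEven y z + absentEven y z) + sumBinary n anyAbsent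
    ≡⟨ sumBinary-+ n (λ y z → presentEven y z + absentEven y z) anyAbsent ⟨
  sumBinary n (λ y z → presentEven y z + absentEven y z + anyAbsent y z)
    ≡⟨ sumBinary-cong n (from-yes (∀-Class²? λ y z →
         presentEven y z + absentEven y z + anyAbsent y z ≟ℕ 𝟙 (not (z == odd)))) ⟩
  sumBinary n (λ _ z → 𝟙 (not (z == odd))) ∎
  where open ≡-Reasoning

sumBinary-oddPresent : ∀ n → sumBinary n oddPresent + 𝟙 (class n == odd) ≡
                             sumBinary n (λ _ z → 𝟙 (z == odd))
sumBinary-oddPresent n = begin
  sumBinary n oddPresent + 𝟙 (class n == odd)
    ≡⟨ cong₂ _+_ (sumBinary-flip n oddPresent)
                 (sumBinary-absent n absentOdd λ { absent _ → refl ; even _ → refl ; odd _ → refl }) ⟨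
  sumBinary n (flip oddPresent) + sumBinary n absentOdd
    ≡⟨ sumBinary-+ n (flip oddPresent) absentOdd ⟨
  sumBinary n (λ y z → oddPresent z y + absentOdd y z)
    ≡⟨ sumBinary-cong n (from-yes (∀-Class²? λ y z → oddPresent z y + absentOdd y z ≟ℕ 𝟙 (z == odd))) ⟩
  sumBinary n (λ _ z → 𝟙 (z == odd)) ∎
  where open ≡-Reasoning

excess-class : ∀ m → (if isEven (suc m) then 2 else 3) ≡
               𝟙 (class (suc m) == even) + 1 + 𝟙 (class (suc m) == odd) + 𝟙 (class (suc m) == odd)
excess-class m rewrite isEven-class (suc m) with class m
... | absent = refl
... | even   = refl
... | odd    = refl

zeroCount-suc : ∀ m → zeroCount (suc m) + (if isEven (suc m) then 2 else 3) ≡ 3 * 2 ^ m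
zeroCount-suc m = begin
  zeroCount (suc m) + (if isEven (suc m) then 2 else 3)
    ≡⟨ cong₂ _+_ (zeroCount-split (suc m)) (excess-class m) ⟩
  PE + OP + OP + (E + 1 + O + O)                      ≡⟨ regroup PE OP E O ⟩
  (PE + E + 1) + (OP + O) + (OP + O)                  ≡⟨ cong₂ _+_ (cong₂ _+_ PE-count OP-count) OP-count ⟩
  2 ^ m + 2 ^ m + 2 ^ m                               ≡⟨ m+m+m≡3*m (2 ^ m) ⟩
  3 * 2 ^ m                                           ∎
  where
  open ≡-Reasoning
  PE = sumBinary (suc m) presentEven
  OP = sumBinary (suc m) oddPresent
  E  = 𝟙 (class (suc m) == even)
  O  = 𝟙 (class (suc m) == odd)
  regroup : ∀ p q e o → p + q + q + (e + 1 + o + o) ≡ p + e + 1 + (q + o) + (q + o)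
  regroup = solve-∀
  PE-count : PE + E + 1 ≡ 2 ^ m
  PE-count = trans (sumBinary-presentEven (suc m))
    (sumBinary-alternating (λ z → not (z == odd)) (λ { absent → refl ; even → refl ; odd → refl }) m)
  OP-count : OP + O ≡ 2 ^ m
  OP-count = trans (sumBinary-oddPresent (suc m))
    (sumBinary-alternating (_== odd) (λ { absent → refl ; even → refl ; odd → refl }) m)

N-A≡sumWords : ∀ d → N (A d) ≡ sumWords d (λ s → 𝟙 (not (isZeroEntry s)))
N-A≡sumWords d = begin
  length (filter (λ α → ¬? (A d α ≟ 0ℚ)) (allIndices d))
    ≡⟨ length-filter≡sum (λ α → ¬? (A d α ≟ 0ℚ)) (allIndices d) ⟩
  sum (map (λ α → 𝟙 (not (does (A d α ≟ 0ℚ)))) (allIndices d))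
    ≡⟨ cong sum (map-cong (λ α → cong (λ q → 𝟙 (not (does (q ≟ 0ℚ)))) (A≡entryOf-type α)) (allIndices d)) ⟩
  sum (map (λ α → 𝟙 (not (isZeroEntry (type α)))) (allIndices d))
    ≡⟨ sum-map-type d (λ s → 𝟙 (not (isZeroEntry s))) ⟩
  sumWords d (λ s → 𝟙 (not (isZeroEntry s))) ∎
  where open ≡-Reasoning

N-A+zeroCount : ∀ d → N (A d) + zeroCount d ≡ 3 ^ d
N-A+zeroCount d = begin
  N (A d) + zeroCount d
    ≡⟨ cong (_+ zeroCount d) (N-A≡sumWords d) ⟩
  sumWords d (λ s → 𝟙 (not (isZeroEntry s))) + sumWords d (𝟙 ∘ isZeroEntry)
    ≡⟨ sumWords-+ d (λ s → 𝟙 (not (isZeroEntry s))) (𝟙 ∘ isZeroEntry) ⟨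
  sumWords d (λ s → 𝟙 (not (isZeroEntry s)) + 𝟙 (isZeroEntry s))
    ≡⟨ sumWords-cong d (𝟙-not+𝟙 ∘ isZeroEntry) ⟩
  sumWords d (const 1)
    ≡⟨ sumWords-1 d ⟩
  3 ^ d ∎
  where open ≡-Reasoning

+-∸-recover : ∀ {a b c t x} → a + b ≡ t → b + c ≡ x → x ≤ t → a ≡ t ∸ x + c
+-∸-recover {a} {b} {c} refl refl b+c≤a+b = sym (begin
  a + b ∸ (b + c) + c  ≡⟨ cong (λ t → t ∸ (b + c) + c) (+-comm a b) ⟩
  b + a ∸ (b + c) + c  ≡⟨ cong (_+ c) ([m+n]∸[m+o]≡n∸o b a c) ⟩
  a ∸ c + c            ≡⟨ m∸n+n≡m (+-cancelˡ-≤ b c a (subst (b + c ≤_) (+-comm a b) b+c≤a+b)) ⟩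
  a                    ∎)
  where open ≡-Reasoning

N-A : ∀ m {b} → isEven (suc m) ≡ b → N (A (suc m)) ≡ 3 ^ suc m ∸ 3 * 2 ^ m + (if b then 2 else 3)
N-A m refl = +-∸-recover (N-A+zeroCount (suc m)) (zeroCount-suc m)
  (*-monoʳ-≤ 3 (^-monoˡ-≤ m (s≤s (s≤s z≤n))))

-- Everything holds for d ≥ 1; the hypothesis 2 ≤ d only excludes d = 0.
proposition7 : (d : ℕ) → 2 ≤ d →
    Polystochastic (A d) ×
    ((isEven d ≡ true → N (A d) ≡ 3 ^ d ∸ 3 * 2 ^ (d ∸ 1) + 2) ×
     (isEven d ≡ false → N (A d) ≡ 3 ^ d ∸ 3 * 2 ^ (d ∸ 1) + 3))
proposition7 zero    ()
proposition7 (suc d) _ = A-polystochastic (suc d) , N-A d , N-A d
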